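{- Let $p$ be a prime, $n$ a positive integer, and $t_1,\dots,t_n\in\mathbb{Q}$. Define $s_1=t_1$ and $s_i=\{s_{i-1}\}+t_i$ for $2\le i\le n$, where $\{x\}=x-\lfloor x\rfloor$. Suppose there is a positive integer $b$ with $s_ib\in\mathbb{Z}$ and $t_ib\in\mathbb{Z}$ for all $i$, and suppose $s_n\in\mathbb{Z}$. Then $$\sum_{i=1}^{n}\frac{\lfloor s_i\rfloor}{p^i}\ \ge\ \sum_{i=1}^{n}\frac{t_i}{p^i}+\left(\frac1p-\frac1{p^n}\right)\left(\frac1b-1\right),$$ with equality if and only if $s_i+\frac1b\in\mathbb{Z}$ for all $i<n$. -}

module Defs where

open import Data.Nat.Base as ℕ using (ℕ; zero; suc; NonZero)
open import Data.Nat.Properties using (m^n≢0)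
open import Data.Nat.Primality using (Prime; prime⇒nonZero)
open import Data.Integer.Base using (ℤ; +_)
open import Data.Rational.Base
open import Data.Product.Base using (∃)
open import Relation.Binary.PropositionalEquality using (_≡_)

ι : ℤ → ℚ
ι z = z / 1

IsInt : ℚ → Set
IsInt x = ∃ λ (z : ℤ) → x ≡ ι z

-- fractional part {x} = x - ⌊x⌋  (floor rounds towards -∞)
frac : ℚ → ℚ
frac x = x - ι (floor x)

-- s₀ = 0 (so {s₀} = 0 and s₁ = t₁), s_i = {s_{i-1}} + t_i
s : (ℕ → ℚ) → ℕ → ℚ
s t zero = 0ℚ
s t (suc i) = frac (s t i) + t (suc i)

invPow : (p : ℕ) → Prime p → ℕ → ℚ
invPow p pr i = (+ 1 / (p ℕ.^ i)) {{m^n≢0 p i {{prime⇒nonZero pr}}}}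

Σ₁ : ℕ → (ℕ → ℚ) → ℚ
Σ₁ zero f = 0ℚ
Σ₁ (suc n) f = Σ₁ n f + f (suc n)

module Submission where

-- Write dᵢ = {sᵢ} for the fractional parts; d₀ = 0, and dₙ = 0 because sₙ ∈ ℤ.
-- Since ⌊sᵢ⌋ = sᵢ - dᵢ = dᵢ₋₁ + tᵢ - dᵢ, summation by parts gives, for any
-- weights w,
--     Σᵢ₌₁ⁿ ⌊sᵢ⌋ wᵢ  =  Σᵢ₌₁ⁿ tᵢ wᵢ  +  Σᵢ₌₁ⁿ⁻¹ dᵢ (wᵢ₊₁ - wᵢ)          (*)
-- For wᵢ = p⁻ⁱ the differences wᵢ₊₁ - wᵢ are negative, and since sᵢ b ∈ ℤ we
-- have dᵢ ≤ 1 - 1/b.  So every term of the last sum is at least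
-- (1 - 1/b)(wᵢ₊₁ - wᵢ); these telescope to (1/p - 1/pⁿ)(1/b - 1), which gives
-- the inequality, with equality iff dᵢ = 1 - 1/b, i.e. sᵢ + 1/b ∈ ℤ, for i < n.

open import Defs
open import Data.Nat.Base as ℕ using (ℕ)
open import Data.Nat.Primality using (Prime)
open import Data.Integer.Base using (+_)
open import Data.Rational.Base
open import Data.Product.Base using (_×_)
open import Function.Bundles using (_⇔_)
open import Relation.Binary.PropositionalEquality using (_≡_)

open import Data.Nat.Base using (zero; suc)
import Data.Nat.Properties as ℕP
import Data.Nat.Coprimality as Coprime
open import Data.Nat.Primality using (prime⇒nonZero; prime⇒nonTrivial)
open import Data.Integer.Base as ℤ using (ℤ)
import Data.Integer.Properties as ℤP
import Data.Integer.DivMod as ℤD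
open import Data.Rational.Properties
import Data.Rational.Unnormalised.Base as U
import Data.Rational.Unnormalised.Properties as UP
open import Data.Rational.Solver using (module +-*-Solver)
open import Algebra.Properties.Group +-0-group using (∙-cancelˡ)
open import Data.Product.Base using (_,_; proj₁; proj₂)
open import Data.Sum.Base using (_⊎_; inj₁; inj₂)
open import Data.Empty using (⊥-elim)
open import Function.Bundles using (mk⇔; Equivalence)
open import Function.Construct.Composition using (_⇔-∘_)
open import Relation.Binary.PropositionalEquality
  using (refl; sym; trans; cong; cong₂; subst; subst₂; module ≡-Reasoning)

open +-*-Solver using (solve; _:+_; _:-_; :-_; _:*_; _:=_; con)

-- The rational in lowest terms with numerator z and denominator 1; ι z is
-- equal to it, and in this normal form the order and ring laws of ι can be
-- read off from those of ℤ.
integral : ℤ → ℚ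
integral z = mkℚ z 0 (Coprime.sym (Coprime.1-coprimeTo ℤ.∣ z ∣))

ι-normal : ∀ z → ι z ≡ integral z
ι-normal z = toℚᵘ-injective (toℚᵘ-fromℚᵘ (U.mkℚᵘ z 0))

ι-+ : ∀ a b → ι (a ℤ.+ b) ≡ ι a + ι b
ι-+ a b rewrite ι-normal (a ℤ.+ b) | ι-normal a | ι-normal b =
  toℚᵘ-injective (UP.≃-sym (UP.≃-trans (toℚᵘ-homo-+ (integral a) (integral b))
    (U.*≡* (cong (ℤ._* + 1) (cong₂ ℤ._+_ (ℤP.*-identityʳ a) (ℤP.*-identityʳ b))))))

ι-* : ∀ a b → ι (a ℤ.* b) ≡ ι a * ι b
ι-* a b rewrite ι-normal (a ℤ.* b) | ι-normal a | ι-normal b =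
  toℚᵘ-injective (UP.≃-sym (UP.≃-trans (toℚᵘ-homo-* (integral a) (integral b)) (U.*≡* refl)))

ι-neg : ∀ a → ι (ℤ.- a) ≡ - ι a
ι-neg a rewrite ι-normal (ℤ.- a) | ι-normal a = toℚᵘ-injective (UP.≃-sym (toℚᵘ-homo‿- (integral a)))

ι-suc : ∀ a → ι (ℤ.suc a) ≡ ι a + 1ℚ
ι-suc a = trans (ι-+ (+ 1) a) (+-comm 1ℚ (ι a))

ι-mono-≤ : ∀ {a b} → a ℤ.≤ b → ι a ≤ ι b
ι-mono-≤ {a} {b} a≤b rewrite ι-normal a | ι-normal b =
  *≤* (subst₂ ℤ._≤_ (sym (ℤP.*-identityʳ a)) (sym (ℤP.*-identityʳ b)) a≤b)

ι-mono-< : ∀ {a b} → a ℤ.< b → ι a < ι b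
ι-mono-< {a} {b} a<b rewrite ι-normal a | ι-normal b =
  *<* (subst₂ ℤ._<_ (sym (ℤP.*-identityʳ a)) (sym (ℤP.*-identityʳ b)) a<b)

ι-cancel-≤ : ∀ {a b} → ι a ≤ ι b → a ℤ.≤ b
ι-cancel-≤ {a} {b} ιa≤ιb rewrite ι-normal a | ι-normal b with ιa≤ιb
... | *≤* a≤b = subst₂ ℤ._≤_ (ℤP.*-identityʳ a) (ℤP.*-identityʳ b) a≤b

ι-cancel-< : ∀ {a b} → ι a < ι b → a ℤ.< b
ι-cancel-< {a} {b} ιa<ιb rewrite ι-normal a | ι-normal b with ιa<ιb
... | *<* a<b = subst₂ ℤ._<_ (ℤP.*-identityʳ a) (ℤP.*-identityʳ b) a<b

ι-gap : ∀ {a b} → ι a < ι b → ι a + 1ℚ ≤ ι b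
ι-gap {a} {b} ιa<ιb =
  subst (_≤ ι b) (ι-suc a) (ι-mono-≤ (ℤP.i<j⇒suc[i]≤j (ι-cancel-< {a} {b} ιa<ιb)))

0<1 : 0ℚ < 1ℚ
0<1 = *<* (ℤ.+<+ (ℕ.s≤s ℕ.z≤n))

<+pos : ∀ x {ε} → 0ℚ < ε → x < x + ε
<+pos x 0<ε = subst (_< x + _) (+-identityʳ x) (+-monoʳ-< x 0<ε)

difference-negative : ∀ {a b} → a < b → Negative (a - b)
difference-negative {a} {b} a<b = negative (subst (a - b <_) (+-inverseʳ b) (+-monoˡ-< (- b) a<b))

+-cancelʳ-≤ : ∀ a b c → a + c ≤ b + c → a ≤ b
+-cancelʳ-≤ a b c le = subst₂ _≤_ (cancel a) (cancel b) (+-monoˡ-≤ (- c) le)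
  where
  cancel : ∀ x → x + c - c ≡ x
  cancel x = solve 2 (λ x c → x :+ c :- c := x) refl x c

+-≤-equality : ∀ {a a′ b b′} → a′ ≤ a → b′ ≤ b → a + b ≡ a′ + b′ → a ≡ a′ × b ≡ b′
+-≤-equality {a} {a′} {b} {b′} a′≤a b′≤b eq = ≤-antisym a≤a′ a′≤a , ≤-antisym b≤b′ b′≤b
  where
  open ≤-Reasoning
  a≤a′ : a ≤ a′
  a≤a′ = +-cancelʳ-≤ a a′ b (begin a + b ≡⟨ eq ⟩ a′ + b′ ≤⟨ +-monoʳ-≤ a′ b′≤b ⟩ a′ + b ∎)
  b≤b′ : b ≤ b′
  b≤b′ = +-cancelʳ-≤ b b′ a (begin
    b + a   ≡⟨ +-comm b a ⟩
    a + b   ≡⟨ eq ⟩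
    a′ + b′ ≤⟨ +-monoˡ-≤ b′ a′≤a ⟩
    a + b′  ≡⟨ +-comm a b′ ⟩
    b′ + a  ∎)

unit-fraction-normal : ∀ k → + 1 / suc k ≡ mkℚ (+ 1) k (Coprime.1-coprimeTo (suc k))
unit-fraction-normal k = toℚᵘ-injective (toℚᵘ-fromℚᵘ (U.mkℚᵘ (+ 1) k))

1/N-pos : ∀ N .{{_ : ℕ.NonZero N}} → 0ℚ < + 1 / N
1/N-pos (suc k) rewrite unit-fraction-normal k = *<* (ℤ.+<+ (ℕ.s≤s ℕ.z≤n))

1/N≤1 : ∀ N .{{_ : ℕ.NonZero N}} → + 1 / N ≤ 1ℚ
1/N≤1 (suc k) rewrite unit-fraction-normal k = *≤* (ℤ.+≤+ (ℕ.s≤s ℕ.z≤n))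

1/-anti-< : ∀ N M .{{_ : ℕ.NonZero N}} .{{_ : ℕ.NonZero M}} → N ℕ.< M → + 1 / M < + 1 / N
1/-anti-< (suc k) (suc l) N<M rewrite unit-fraction-normal k | unit-fraction-normal l =
  *<* (subst₂ ℤ._<_ (sym (ℤP.*-identityˡ (+ suc k))) (sym (ℤP.*-identityˡ (+ suc l))) (ℤ.+<+ N<M))

N*1/N : ∀ N .{{_ : ℕ.NonZero N}} → ι (+ N) * (+ 1 / N) ≡ 1ℚ
N*1/N (suc k) rewrite unit-fraction-normal k | ι-normal (+ suc k) =
  toℚᵘ-injective (UP.≃-trans (toℚᵘ-homo-* (integral (+ suc k)) (mkℚ (+ 1) k (Coprime.1-coprimeTo (suc k))))
                             (U.*≡* (cong (λ m → + suc m) k*1*1≡k+0+0)))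
  where
  k*1*1≡k+0+0 : k ℕ.* 1 ℕ.* 1 ≡ k ℕ.+ 0 ℕ.+ 0
  k*1*1≡k+0+0 = begin
    k ℕ.* 1 ℕ.* 1  ≡⟨ ℕP.*-identityʳ (k ℕ.* 1) ⟩
    k ℕ.* 1        ≡⟨ ℕP.*-identityʳ k ⟩
    k              ≡⟨ sym (ℕP.+-identityʳ k) ⟩
    k ℕ.+ 0        ≡⟨ sym (ℕP.+-identityʳ (k ℕ.+ 0)) ⟩
    k ℕ.+ 0 ℕ.+ 0  ∎
    where open ≡-Reasoning

floor-quotient : ∀ x → floor x ≡ ↥ x ℤD./ℕ ↧ₙ x
floor-quotient (mkℚ n d _) = ℤD.div-pos-is-/ℕ n (suc d)

floor-≤ : ∀ x → ι (floor x) ≤ x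
floor-≤ x@(mkℚ n d _) rewrite floor-quotient x | ι-normal (n ℤD./ℕ suc d) =
  *≤* (subst (ℤ._≤_ _) (sym (ℤP.*-identityʳ n)) (ℤD.[n/ℕd]*d≤n n (suc d)))

floor-< : ∀ x → x < ι (floor x) + 1ℚ
floor-< x = subst (x <_) (ι-suc (floor x)) (below-suc x)
  where
  below-suc : ∀ x → x < ι (ℤ.suc (floor x))
  below-suc x@(mkℚ n d _) rewrite floor-quotient x | ι-normal (ℤ.suc (n ℤD./ℕ suc d)) =
    *<* (subst (ℤ._< (ℤ.suc (n ℤD./ℕ suc d) ℤ.* + suc d)) (sym (ℤP.*-identityʳ n))
             (ℤD.n<s[n/ℕd]*d n (suc d)))

ι-<-suc⇒≤ : ∀ {a b} → ι a < ι b + 1ℚ → a ℤ.≤ b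
ι-<-suc⇒≤ {a} {b} ιa<ιb+1 =
  ι-cancel-≤ (+-cancelʳ-≤ (ι a) (ι b) 1ℚ
    (subst (ι a + 1ℚ ≤_) (ι-suc b) (ι-gap {a} {ℤ.suc b} (subst (ι a <_) (sym (ι-suc b)) ιa<ιb+1))))

floor-unique : ∀ x k → ι k ≤ x → x < ι k + 1ℚ → floor x ≡ k
floor-unique x k k≤x x<k+1 =
  ℤP.≤-antisym (ι-<-suc⇒≤ (≤-<-trans (floor-≤ x) x<k+1))
               (ι-<-suc⇒≤ (≤-<-trans k≤x (floor-< x)))

frac<1 : ∀ x → frac x < 1ℚ
frac<1 x = subst (frac x <_) (f+1-f≡1 (ι (floor x))) (+-monoˡ-< (- ι (floor x)) (floor-< x))
  where
  f+1-f≡1 : ∀ f → f + 1ℚ - f ≡ 1ℚ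
  f+1-f≡1 = solve 1 (λ f → f :+ con 1ℚ :- f := con 1ℚ) refl

frac-ι : ∀ z → frac (ι z) ≡ 0ℚ
frac-ι z = trans (cong (λ k → ι z - ι k) (floor-unique (ι z) z ≤-refl (<+pos (ι z) 0<1)))
                 (+-inverseʳ (ι z))

module _ (b : ℕ) .{{_ : ℕ.NonZero b}} where

  private
    B 1/b : ℚ
    B = ι (+ b)
    1/b = + 1 / b

  -- If x b ∈ ℤ then {x} is a multiple of 1/b below 1, hence {x} ≤ 1 - 1/b.
  frac-grid-≤ : ∀ x → IsInt (x * B) → frac x ≤ 1ℚ - 1/b
  frac-grid-≤ x (m , xB≡m) = +-cancelʳ-≤ (frac x) (1ℚ - 1/b) 1/b (begin
      frac x + 1/b      ≡⟨ frac+1/b≡ ⟩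
      (ι r + 1ℚ) * 1/b  ≤⟨ *-monoʳ-≤-nonNeg 1/b {{nonNegative (<⇒≤ (1/N-pos b))}} (ι-gap {r} {+ b} r<B) ⟩
      B * 1/b           ≡⟨ N*1/N b ⟩
      1ℚ                ≡⟨ solve 1 (λ i → con 1ℚ := con 1ℚ :- i :+ i) refl 1/b ⟩
      1ℚ - 1/b + 1/b    ∎)
    where
    open ≤-Reasoning
    f : ℚ
    f = ι (floor x)
    -- r = x b - ⌊x⌋ b, the integer numerator of {x} over the denominator b
    r : ℤ
    r = m ℤ.- floor x ℤ.* + b
    ιr≡ : ι r ≡ frac x * B
    ιr≡ rewrite ι-+ m (ℤ.- (floor x ℤ.* + b)) | ι-neg (floor x ℤ.* + b) | ι-* (floor x) (+ b) | sym xB≡m =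
      solve 3 (λ x f B → x :* B :+ (:- (f :* B)) := (x :- f) :* B) refl x f B
    r<B : ι r < B
    r<B = subst₂ _<_ (sym ιr≡) (*-identityˡ B) (*-monoˡ-<-pos B {{positive B-pos}} (frac<1 x))
      where
      B-pos : 0ℚ < B
      B-pos = ι-mono-< (ℤ.+<+ (ℕ.>-nonZero⁻¹ b))
    frac+1/b≡ : frac x + 1/b ≡ (ι r + 1ℚ) * 1/b
    frac+1/b≡ rewrite ιr≡ = begin-equality
      frac x + 1/b                ≡⟨ cong (_+ 1/b) (sym (*-identityʳ (frac x))) ⟩
      frac x * 1ℚ + 1/b           ≡⟨ cong (λ e → frac x * e + 1/b) (sym (N*1/N b)) ⟩
      frac x * (B * 1/b) + 1/b    ≡⟨ solve 3 (λ F B I → F :* (B :* I) :+ I := (F :* B :+ con 1ℚ) :* I) refl (frac x) B 1/b ⟩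
      (frac x * B + 1ℚ) * 1/b     ∎

  -- If {x} = 1 - 1/b then x + 1/b = ⌊x⌋ + 1.
  frac-max⇒grid : ∀ x → frac x ≡ 1ℚ - 1/b → IsInt (x + 1/b)
  frac-max⇒grid x frac≡max = ℤ.suc (floor x) , (begin
      x + 1/b                ≡⟨ solve 3 (λ x f I → x :+ I := f :+ (x :- f) :+ I) refl x f 1/b ⟩
      f + frac x + 1/b       ≡⟨ cong (λ e → f + e + 1/b) frac≡max ⟩
      f + (1ℚ - 1/b) + 1/b   ≡⟨ solve 2 (λ f I → f :+ (con 1ℚ :- I) :+ I := f :+ con 1ℚ) refl f 1/b ⟩
      f + 1ℚ                 ≡⟨ sym (ι-suc (floor x)) ⟩
      ι (ℤ.suc (floor x))    ∎)
    where
    open ≡-Reasoning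
    f : ℚ
    f = ι (floor x)

  -- If x + 1/b = k ∈ ℤ then ⌊x⌋ = k - 1, so {x} = 1 - 1/b.
  grid⇒frac-max : ∀ x → IsInt (x + 1/b) → frac x ≡ 1ℚ - 1/b
  grid⇒frac-max x (k , x+1/b≡k) = begin-equality
      x - ι (floor x)         ≡⟨ cong (λ z → x - ι z) (floor-unique x (ℤ.pred k) j≤x x<j+1) ⟩
      x - j                   ≡⟨ cong (_- j) x≡j+1-1/b ⟩
      j + 1ℚ - 1/b - j        ≡⟨ solve 2 (λ j I → j :+ con 1ℚ :- I :- j := con 1ℚ :- I) refl j 1/b ⟩
      1ℚ - 1/b                ∎
    where
    open ≤-Reasoning
    j : ℚ
    j = ι (ℤ.pred k)
    k≡j+1 : ι k ≡ j + 1ℚ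
    k≡j+1 = trans (cong ι (sym (ℤP.suc-pred k))) (ι-suc (ℤ.pred k))
    x≡j+1-1/b : x ≡ j + 1ℚ - 1/b
    x≡j+1-1/b = begin-equality
      x                 ≡⟨ solve 2 (λ x I → x := x :+ I :- I) refl x 1/b ⟩
      x + 1/b - 1/b     ≡⟨ cong (_- 1/b) (trans x+1/b≡k k≡j+1) ⟩
      j + 1ℚ - 1/b      ∎
    j≤x : j ≤ x
    j≤x = begin
      j                 ≡⟨ solve 1 (λ j → j := j :+ con 1ℚ :- con 1ℚ) refl j ⟩
      j + 1ℚ - 1ℚ       ≤⟨ +-monoʳ-≤ (j + 1ℚ) (neg-antimono-≤ (1/N≤1 b)) ⟩
      j + 1ℚ - 1/b      ≡⟨ sym x≡j+1-1/b ⟩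
      x                 ∎
    x<j+1 : x < j + 1ℚ
    x<j+1 = begin-strict
      x                 <⟨ <+pos x (1/N-pos b) ⟩
      x + 1/b           ≡⟨ trans x+1/b≡k k≡j+1 ⟩
      j + 1ℚ            ∎

  frac-max⇔grid : ∀ x → frac x ≡ 1ℚ - 1/b ⇔ IsInt (x + 1/b)
  frac-max⇔grid x = mk⇔ (frac-max⇒grid x) (grid⇒frac-max x)

∀₁ : ℕ → (ℕ → Set) → Set
∀₁ m P = ∀ i → 1 ℕ.≤ i → i ℕ.≤ m → P i

∀₁-init : ∀ {m P} → ∀₁ (suc m) P → ∀₁ m P
∀₁-init all i 1≤i i≤m = all i 1≤i (ℕP.m≤n⇒m≤1+n i≤m)

∀₁-last : ∀ {m P} → ∀₁ (suc m) P → P (suc m)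
∀₁-last all = all _ (ℕ.s≤s ℕ.z≤n) ℕP.≤-refl

Σ₁-+ : ∀ m f g → Σ₁ m (λ i → f i + g i) ≡ Σ₁ m f + Σ₁ m g
Σ₁-+ zero    f g = refl
Σ₁-+ (suc m) f g = trans (cong (_+ (f (suc m) + g (suc m))) (Σ₁-+ m f g))
  (solve 4 (λ F G x y → (F :+ G) :+ (x :+ y) := (F :+ x) :+ (G :+ y)) refl
           (Σ₁ m f) (Σ₁ m g) (f (suc m)) (g (suc m)))

Σ₁-cong : ∀ m f g → ∀₁ m (λ i → f i ≡ g i) → Σ₁ m f ≡ Σ₁ m g
Σ₁-cong zero    f g f≡g = refl
Σ₁-cong (suc m) f g f≡g = cong₂ _+_ (Σ₁-cong m f g (∀₁-init f≡g)) (∀₁-last f≡g)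

Σ₁-mono : ∀ m f g → ∀₁ m (λ i → g i ≤ f i) → Σ₁ m g ≤ Σ₁ m f
Σ₁-mono zero    f g g≤f = ≤-refl
Σ₁-mono (suc m) f g g≤f = +-mono-≤ (Σ₁-mono m f g (∀₁-init g≤f)) (∀₁-last g≤f)

Σ₁-mono-equality : ∀ m f g → ∀₁ m (λ i → g i ≤ f i) → Σ₁ m f ≡ Σ₁ m g → ∀₁ m (λ i → f i ≡ g i)
Σ₁-mono-equality zero    f g g≤f eq i 1≤i i≤0 = ⊥-elim (ℕP.<⇒≱ 1≤i i≤0)
Σ₁-mono-equality (suc m) f g g≤f eq i 1≤i i≤m+1 = by-position (ℕP.m≤n⇒m<n∨m≡n i≤m+1)
  where
  init-and-last : Σ₁ m f ≡ Σ₁ m g × f (suc m) ≡ g (suc m)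
  init-and-last = +-≤-equality (Σ₁-mono m f g (∀₁-init g≤f)) (∀₁-last g≤f) eq
  by-position : i ℕ.< suc m ⊎ i ≡ suc m → f i ≡ g i
  by-position (inj₁ i<m+1) =
    Σ₁-mono-equality m f g (∀₁-init g≤f) (proj₁ init-and-last) i 1≤i (ℕ.s≤s⁻¹ i<m+1)
  by-position (inj₂ refl) = proj₂ init-and-last

summation-by-parts : ∀ m (d w : ℕ → ℚ) →
  Σ₁ (suc m) (λ i → (d (ℕ.pred i) - d i) * w i)
    ≡ d 0 * w 1 - d (suc m) * w (suc m) + Σ₁ m (λ i → d i * (w (suc i) - w i))
summation-by-parts zero    d w =
  solve 3 (λ d₀ d₁ w₁ → con 0ℚ :+ (d₀ :- d₁) :* w₁ := d₀ :* w₁ :- d₁ :* w₁ :+ con 0ℚ) refl (d 0) (d 1) (w 1)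
summation-by-parts (suc m) d w =
  trans (cong (_+ (d (suc m) - d (suc (suc m))) * w (suc (suc m))) (summation-by-parts m d w))
    (solve 6 (λ A dₘ wₘ dₘ₊₁ wₘ₊₁ S →
                A :- dₘ :* wₘ :+ S :+ (dₘ :- dₘ₊₁) :* wₘ₊₁
             := A :- dₘ₊₁ :* wₘ₊₁ :+ (S :+ dₘ :* (wₘ₊₁ :- wₘ))) refl
       (d 0 * w 1) (d (suc m)) (w (suc m)) (d (suc (suc m))) (w (suc (suc m)))
       (Σ₁ m (λ i → d i * (w (suc i) - w i))))

telescope : ∀ m c (w : ℕ → ℚ) → Σ₁ m (λ i → c * (w (suc i) - w i)) ≡ c * (w (suc m) - w 1)
telescope zero    c w = solve 2 (λ c w₁ → con 0ℚ := c :* (w₁ :- w₁)) refl c (w 1)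
telescope (suc m) c w = trans (cong (_+ c * (w (suc (suc m)) - w (suc m))) (telescope m c w))
  (solve 4 (λ c wₘ wₘ₊₁ w₁ → c :* (wₘ :- w₁) :+ c :* (wₘ₊₁ :- wₘ) := c :* (wₘ₊₁ :- w₁)) refl
           c (w (suc m)) (w (suc (suc m))) (w 1))

Σ₁-negative-weights : ∀ m (d δ : ℕ → ℚ) c → (∀ i → Negative (δ i)) → ∀₁ m (λ i → d i ≤ c) →
  Σ₁ m (λ i → c * δ i) ≤ Σ₁ m (λ i → d i * δ i)
    × (Σ₁ m (λ i → d i * δ i) ≡ Σ₁ m (λ i → c * δ i) ⇔ ∀₁ m (λ i → d i ≡ c))
Σ₁-negative-weights m d δ c δ<0 d≤c =
  Σ₁-mono m _ _ term-≤ , mk⇔ equal-terms (λ d≡c → Σ₁-cong m _ _ (λ i 1≤i i≤m → cong (_* δ i) (d≡c i 1≤i i≤m)))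
  where
  term-≤ : ∀₁ m (λ i → c * δ i ≤ d i * δ i)
  term-≤ i 1≤i i≤m = *-monoʳ-≤-nonPos (δ i) {{neg⇒nonPos (δ i) {{δ<0 i}}}} (d≤c i 1≤i i≤m)
  equal-terms : Σ₁ m (λ i → d i * δ i) ≡ Σ₁ m (λ i → c * δ i) → ∀₁ m (λ i → d i ≡ c)
  equal-terms eq i 1≤i i≤m = ≤-antisym (*-cancelʳ-≤-neg (δ i) {{δ<0 i}} (≤-reflexive (sym dδ≡cδ)))
                                       (*-cancelʳ-≤-neg (δ i) {{δ<0 i}} (≤-reflexive dδ≡cδ))
    where
    dδ≡cδ : d i * δ i ≡ c * δ i
    dδ≡cδ = Σ₁-mono-equality m _ _ term-≤ eq i 1≤i i≤m

floor-sum : ∀ t (w : ℕ → ℚ) m → frac (s t (suc m)) ≡ 0ℚ →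
  Σ₁ (suc m) (λ i → ι (floor (s t i)) * w i)
    ≡ Σ₁ (suc m) (λ i → t i * w i) + Σ₁ m (λ i → frac (s t i) * (w (suc i) - w i))
floor-sum t w m frac-sₘ₊₁≡0 = begin
    Σ₁ (suc m) (λ i → ι (floor (s t i)) * w i)
  ≡⟨ Σ₁-cong (suc m) _ _ (λ { (suc j) _ _ → floor-step j }) ⟩
    Σ₁ (suc m) (λ i → t i * w i + (d (ℕ.pred i) - d i) * w i)
  ≡⟨ Σ₁-+ (suc m) _ _ ⟩
    T + Σ₁ (suc m) (λ i → (d (ℕ.pred i) - d i) * w i)
  ≡⟨ cong (λ e → T + e) (summation-by-parts m d w) ⟩
    T + (0ℚ * w 1 - d (suc m) * w (suc m) + E)
  ≡⟨ cong (λ e → T + (0ℚ * w 1 - e * w (suc m) + E)) frac-sₘ₊₁≡0 ⟩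
    T + (0ℚ * w 1 - 0ℚ * w (suc m) + E)
  ≡⟨ cong (λ e → T + e) (solve 3 (λ w₁ wₘ E → con 0ℚ :* w₁ :- con 0ℚ :* wₘ :+ E := E) refl (w 1) (w (suc m)) E) ⟩
    T + E
  ∎
  where
  open ≡-Reasoning
  d : ℕ → ℚ
  d i = frac (s t i)
  T E : ℚ
  T = Σ₁ (suc m) (λ i → t i * w i)
  E = Σ₁ m (λ i → d i * (w (suc i) - w i))
  -- ⌊sⱼ₊₁⌋ = sⱼ₊₁ - dⱼ₊₁ = dⱼ + tⱼ₊₁ - dⱼ₊₁
  floor-step : ∀ j → ι (floor (s t (suc j))) * w (suc j) ≡ t (suc j) * w (suc j) + (d j - d (suc j)) * w (suc j)
  floor-step j = solve 4 (λ F dⱼ tⱼ₊₁ W → F :* W := tⱼ₊₁ :* W :+ (dⱼ :- ((dⱼ :+ tⱼ₊₁) :- F)) :* W) refl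
                   (ι (floor (s t (suc j)))) (d j) (t (suc j)) (w (suc j))

-- The theorem for arbitrary strictly decreasing weights w (the argument never
-- uses wᵢ = p⁻ⁱ beyond this): by (*), the left side is T + Σ {sᵢ} δᵢ with
-- δᵢ = wᵢ₊₁ - wᵢ < 0, and Σ₁-negative-weights compares this with
-- Σ (1 - 1/b) δᵢ, which telescopes to the correction term.
floor-sum-bound : ∀ t (w : ℕ → ℚ) m b .{{_ : ℕ.NonZero b}} → (∀ i → w (suc i) < w i) →
  ∀₁ m (λ i → IsInt (s t i * ι (+ b))) → IsInt (s t (suc m)) →
  let LHS = Σ₁ (suc m) (λ i → ι (floor (s t i)) * w i)
      RHS = Σ₁ (suc m) (λ i → t i * w i) + (w 1 - w (suc m)) * (+ 1 / b - 1ℚ)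
  in RHS ≤ LHS × (LHS ≡ RHS ⇔ ∀₁ m (λ i → frac (s t i) ≡ 1ℚ - + 1 / b))
floor-sum-bound t w m b w-decreasing grid (z , sₘ₊₁≡z) = bound , proj₂ comparison ⇔-∘ cancel-T
  where
  d δ : ℕ → ℚ
  d i = frac (s t i)
  δ i = w (suc i) - w i
  c LHS T R E C : ℚ
  c = 1ℚ - + 1 / b
  LHS = Σ₁ (suc m) (λ i → ι (floor (s t i)) * w i)
  T = Σ₁ (suc m) (λ i → t i * w i)
  R = (w 1 - w (suc m)) * (+ 1 / b - 1ℚ)
  E = Σ₁ m (λ i → d i * δ i)
  C = Σ₁ m (λ i → c * δ i)

  LHS≡T+E : LHS ≡ T + E
  LHS≡T+E = floor-sum t w m (trans (cong frac sₘ₊₁≡z) (frac-ι z))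

  C≡R : C ≡ R
  C≡R = trans (telescope m c w)
    (solve 3 (λ w₁ wₙ i → (con 1ℚ :- i) :* (wₙ :- w₁) := (w₁ :- wₙ) :* (i :- con 1ℚ)) refl
       (w 1) (w (suc m)) (+ 1 / b))

  comparison : C ≤ E × (E ≡ C ⇔ ∀₁ m (λ i → d i ≡ c))
  comparison = Σ₁-negative-weights m d δ c (λ i → difference-negative (w-decreasing i))
                 (λ i 1≤i i≤m → frac-grid-≤ b (s t i) (grid i 1≤i i≤m))

  bound : T + R ≤ LHS
  bound = begin
    T + R   ≡⟨ cong (λ e → T + e) (sym C≡R) ⟩
    T + C   ≤⟨ +-monoʳ-≤ T (proj₁ comparison) ⟩
    T + E   ≡⟨ sym LHS≡T+E ⟩
    LHS     ∎
    where open ≤-Reasoning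

  cancel-T : LHS ≡ T + R ⇔ E ≡ C
  cancel-T = mk⇔ (λ eq → ∙-cancelˡ T E C (trans (sym LHS≡T+E) (trans eq (cong (λ e → T + e) (sym C≡R)))))
                 (λ eq → trans LHS≡T+E (cong (λ e → T + e) (trans eq C≡R)))

invPow-decreasing : ∀ p (pr : Prime p) i → invPow p pr (suc i) < invPow p pr i
invPow-decreasing p pr i =
  1/-anti-< (p ℕ.^ i) (p ℕ.^ suc i) {{pⁱ≢0 i}} {{pⁱ≢0 (suc i)}}
    (subst (p ℕ.^ i ℕ.<_) (ℕP.*-comm (p ℕ.^ i) p) (ℕP.m<m*n (p ℕ.^ i) p {{pⁱ≢0 i}} 1<p))
  where
  pⁱ≢0 : ∀ j → ℕ.NonZero (p ℕ.^ j)
  pⁱ≢0 j = ℕP.m^n≢0 p j {{prime⇒nonZero pr}}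
  1<p : 1 ℕ.< p
  1<p = ℕ.nonTrivial⇒n>1 p {{prime⇒nonTrivial pr}}

-- The theorem is the case wᵢ = p⁻ⁱ, n = m + 1; the equality condition
-- {sᵢ} = 1 - 1/b is restated as sᵢ + 1/b ∈ ℤ.
lemma21 : (p : ℕ) (pr : Prime p) (n : ℕ) → 1 ℕ.≤ n → (t : ℕ → ℚ) → (b : ℕ) → .{{_ : ℕ.NonZero b}} → (∀ i → 1 ℕ.≤ i → i ℕ.≤ n → IsInt (s t i * ι (+ b)) × IsInt (t i * ι (+ b))) → IsInt (s t n) → (Σ₁ n (λ i → ι (floor (s t i)) * invPow p pr i) ≥ Σ₁ n (λ i → t i * invPow p pr i) + (invPow p pr 1 - invPow p pr n) * (+ 1 / b - 1ℚ)) × ((Σ₁ n (λ i → ι (floor (s t i)) * invPow p pr i) ≡ Σ₁ n (λ i → t i * invPow p pr i) + (invPow p pr 1 - invPow p pr n) * (+ 1 / b - 1ℚ)) ⇔ (∀ i → 1 ℕ.≤ i → i ℕ.< n → IsInt (s t i + + 1 / b)))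
lemma21 p pr (suc m) _ t b grid sₙ∈ℤ =
  let (bound , equality) = floor-sum-bound t (invPow p pr) m b (invPow-decreasing p pr) s-grid sₙ∈ℤ
  in bound , frac-max⇔grid-all ⇔-∘ equality
  where
  s-grid : ∀₁ m (λ i → IsInt (s t i * ι (+ b)))
  s-grid i 1≤i i≤m = proj₁ (grid i 1≤i (ℕP.m≤n⇒m≤1+n i≤m))

  frac-max⇔grid-all : ∀₁ m (λ i → frac (s t i) ≡ 1ℚ - + 1 / b)
                      ⇔ (∀ i → 1 ℕ.≤ i → i ℕ.< suc m → IsInt (s t i + + 1 / b))
  frac-max⇔grid-all = mk⇔
    (λ all i 1≤i i<n → Equivalence.to (frac-max⇔grid b (s t i)) (all i 1≤i (ℕ.s≤s⁻¹ i<n)))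
    (λ all i 1≤i i≤m → Equivalence.from (frac-max⇔grid b (s t i)) (all i 1≤i (ℕ.s≤s i≤m)))
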